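{- A graph $G$ is a Cayley graph (i.e. isomorphic to $\mathcal{C}\langle\mathsf{G},\mathsf{H}\rangle$ for some group $\mathsf{G}$, non-empty generating subset $\mathsf{H}$ and injective labelling $\langle\ \rangle:\mathsf{H}\to A$) if and only if $G$ is deterministic, rooted, simple, and has a free transitive action (i.e. there exists some group with a free transitive action on $G$).
   Context: Fix an arbitrary set $A$ of labels. A graph is a non-empty set $G\subseteq V\times A\times V$ of labelled edges $s\xrightarrow{a}t$; $V_G$ is the set of vertices occurring in edges. Isomorphism: bijection $f:V_G\to V_H$ with $s\xrightarrow{a}_G t\iff f(s)\xrightarrow{a}_H f(t)$. $G$ is simple if $s\xrightarrow{a}t,\ s\xrightarrow{b}t\Rightarrow a=b$; deterministic if $r\xrightarrow{a}s,\ r\xrightarrow{a}t\Rightarrow s=t$; rooted if some vertex reaches every vertex by a directed path. An action of a group $\mathsf{G}$ on $G$ is a left group action $\bullet$ of $\mathsf{G}$ on $V_G$ such that $s\xrightarrow{a}_G t$ implies $g\bullet s\xrightarrow{a}_G g\bullet t$; it is free and transitive if for all $s,t\in V_G$ there is a unique $g$ with $g\bullet s=t$. For a group $(\mathsf{G},\cdot)$, non-empty $\mathsf{H}\subseteq\mathsf{G}$ and injective $\langle\ \rangle:\mathsf{H}\to A$, $\mathcal{C}\langle\mathsf{G},\mathsf{H}\rangle=\{(g,\langle h\rangle,g\cdot h)\mid g\in\mathsf{G},h\in\mathsf{H}\}$; $\mathsf{H}$ is generating if every element of $\mathsf{G}$ is a finite product of elements of $\mathsf{H}$. -}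

module Defs where

open import Level using (0ℓ)
open import Data.Product using (Σ; ∃; ∃-syntax; _×_; _,_; proj₁; proj₂; ∃!)
open import Data.Sum using (_⊎_; inj₁)
open import Relation.Binary.PropositionalEquality using (refl)
open import Data.List using (List; map; foldr)
open import Relation.Binary.PropositionalEquality using (_≡_)
open import Relation.Binary.Construct.Closure.ReflexiveTransitive using (Star)
open import Algebra.Structures using (IsGroup)
open import Function.Definitions using (Injective; Bijective)
open import Function.Bundles using (_⇔_)

-- A graph G ⊆ V×A×V is represented by its vertex set V_G (a type whose
-- equality is _≡_) together with its labelled edge relation
-- (s —a→ t holds iff E s a t is inhabited).

record Graph (A : Set) : Set₁ where
  field
    V        : Set
    E        : V → A → V → Set
    nonempty : ∃[ s ] ∃[ a ] ∃[ t ] E s a t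
    occurs   : ∀ v → (∃[ a ] ∃[ t ] E v a t) ⊎ (∃[ s ] ∃[ a ] E s a v)

open Graph public

_≅_ : {A : Set} → Graph A → Graph A → Set
_≅_ {A} G H =
  Σ (V G → V H) λ f →
    Bijective _≡_ _≡_ f ×
    (∀ s (a : A) t → E G s a t ⇔ E H (f s) a (f t))

Simple : {A : Set} → Graph A → Set
Simple {A} G = ∀ s t (a b : A) → E G s a t → E G s b t → a ≡ b

Deterministic : {A : Set} → Graph A → Set
Deterministic {A} G = ∀ r (a : A) s t → E G r a s → E G r a t → s ≡ t

Step : {A : Set} (G : Graph A) → V G → V G → Set
Step G s t = ∃[ a ] E G s a t

Rooted : {A : Set} → Graph A → Set
Rooted G = ∃[ r ] ∀ v → Star (Step G) r v

record Grp : Set₁ where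
  field
    Carrier : Set
    _∙_     : Carrier → Carrier → Carrier
    ε       : Carrier
    _⁻¹     : Carrier → Carrier
    isGroup : IsGroup _≡_ _∙_ ε _⁻¹

record Action {A : Set} (𝔾 : Grp) (G : Graph A) : Set where
  open Grp 𝔾
  field
    _•_      : Carrier → V G → V G
    identity : ∀ v → ε • v ≡ v
    compat   : ∀ g h v → (g ∙ h) • v ≡ g • (h • v)
    edges    : ∀ g s (a : A) t → E G s a t → E G (g • s) a (g • t)

FreeTransitive : {A : Set} {𝔾 : Grp} {G : Graph A} → Action 𝔾 G → Set
FreeTransitive {𝔾 = 𝔾} {G} act =
  ∀ (s t : V G) → ∃! _≡_ (λ (g : Grp.Carrier 𝔾) → Action._•_ act g s ≡ t)

HasFreeTransitiveAction : {A : Set} → Graph A → Set₁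
HasFreeTransitiveAction G = ∃[ 𝔾 ] Σ (Action 𝔾 G) FreeTransitive

-- A subset 𝖧 ⊆ 𝖦 is given as a type K with a map
-- ι : K → 𝖦 (so 𝖧 = image of ι); non-emptiness is witnessed by k₀.
-- The labelling ⟨_⟩ : 𝖧 → A is given by label : K → A, required to be
-- well defined on 𝖧 (ι k ≡ ι k' → label k ≡ label k') and injective on 𝖧
-- (label k ≡ label k' → ι k ≡ ι k').

record CayleyData (A : Set) : Set₁ where
  field
    𝔾      : Grp
    K      : Set
    ι      : K → Grp.Carrier 𝔾
    k₀     : K
    label  : K → A
    label-wd  : ∀ k k' → ι k ≡ ι k' → label k ≡ label k'
    label-inj : ∀ k k' → label k ≡ label k' → ι k ≡ ι k'

  open Grp 𝔾

  prod : List K → Carrier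
  prod ks = foldr _∙_ ε (map ι ks)

  Generating : Set
  Generating = ∀ g → ∃[ ks ] g ≡ prod ks

  cayley : Graph A
  cayley = record
    { V = Carrier
    ; E = λ g a t → ∃[ k ] (label k ≡ a × t ≡ g ∙ ι k)
    ; nonempty = ε , label k₀ , ε ∙ ι k₀ , k₀ , refl , refl
    ; occurs = λ g → inj₁ (label k₀ , g ∙ ι k₀ , k₀ , refl , refl)
    }

IsCayley : {A : Set} → Graph A → Set₁
IsCayley {A} G = Σ (CayleyData A) λ D → CayleyData.Generating D × (G ≅ CayleyData.cayley D)

-- (⇒) All four properties are invariant under isomorphism, so it suffices
-- to check them for a Cayley graph 𝒞⟨𝖦,𝖧⟩ itself: determinism follows from
-- injectivity of the labelling, simplicity from its well-definedness and
-- left cancellation, rootedness (from ε) from 𝖧 being generating, and 𝖦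
-- acts freely and transitively by left multiplication.
--
-- (⇐) Given a root r and a free transitive action of 𝖦, every vertex v is
-- g • r for a unique g = coord v, so coord : V_G → 𝖦 is a bijection.  Take
-- 𝖧 to be the coordinates of the out-neighbours of r, labelled by the label
-- of the edge (well defined by simplicity, injective by determinism).
-- Translating edges by the action shows s —a→ t iff coord t = coord s · h
-- with ⟨h⟩ = a, so coord is an isomorphism onto 𝒞⟨𝖦,𝖧⟩; reading the
-- coordinates along paths from the root shows that 𝖧 generates 𝖦.

module Submission where

open import Defs
open import Data.Product using (Σ; ∃-syntax; _×_; _,_; proj₁; proj₂)
open import Data.List using ([]; _∷_)
open import Function.Bundles using (_⇔_; mk⇔; Equivalence)
open import Relation.Binary.PropositionalEquality
open import Relation.Binary.Construct.Closure.ReflexiveTransitive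
  using (Star; ε; _◅_; gmap)
open import Algebra.Bundles using (Group)
import Algebra.Properties.Group as GroupProperties

-- A group with propositional equality, seen as a standard-library group so
-- that the library's derived group laws apply to it.
asGroup : Grp → Group _ _
asGroup 𝔾 = record { isGroup = Grp.isGroup 𝔾 }

module Iso {A : Set} {G H : Graph A} (iso : G ≅ H) where

  to : V G → V H
  to = proj₁ iso

  from : V H → V G
  from y = proj₁ (proj₂ (proj₁ (proj₂ iso)) y)

  to-injective : ∀ {s t} → to s ≡ to t → s ≡ t
  to-injective = proj₁ (proj₁ (proj₂ iso))

  to-from : ∀ y → to (from y) ≡ y
  to-from y = proj₂ (proj₂ (proj₁ (proj₂ iso)) y) refl

  from-to : ∀ s → from (to s) ≡ s
  from-to s = to-injective (to-from (to s))

  edge-to : ∀ {s a t} → E G s a t → E H (to s) a (to t)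
  edge-to {s} {a} {t} = Equivalence.to (proj₂ (proj₂ iso) s a t)

  edge-from : ∀ {x a y} → E H x a y → E G (from x) a (from y)
  edge-from {x} {a} {y} e = Equivalence.from (proj₂ (proj₂ iso) (from x) a (from y))
    (subst₂ (λ p q → E H p a q) (sym (to-from x)) (sym (to-from y)) e)

module Transport {A : Set} {G H : Graph A} (iso : G ≅ H) where
  open Iso {G = G} {H} iso

  deterministic-≅ : Deterministic H → Deterministic G
  deterministic-≅ detH r a s t e e' =
    to-injective (detH (to r) a (to s) (to t) (edge-to e) (edge-to e'))

  simple-≅ : Simple H → Simple G
  simple-≅ simpH s t a b e e' = simpH (to s) (to t) a b (edge-to e) (edge-to e')

  rooted-≅ : Rooted H → Rooted G
  rooted-≅ (r , reach) = from r , λ v →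
    subst (Star (Step G) (from r)) (from-to v)
      (gmap from (λ (a , e) → a , edge-from e) (reach (to v)))

  freeTransitive-≅ : HasFreeTransitiveAction H → HasFreeTransitiveAction G
  freeTransitive-≅ (𝔾 , actH , ftH) = 𝔾 , actG , ftG
    where
    open Action actH renaming (_•_ to _•ᴴ_)

    actG : Action 𝔾 G
    actG = record
      { _•_      = λ g v → from (g •ᴴ to v)
      ; identity = λ v → trans (cong from (identity (to v))) (from-to v)
      ; compat   = λ g h v → cong from
          (trans (compat g h (to v)) (cong (g •ᴴ_) (sym (to-from (h •ᴴ to v)))))
      ; edges    = λ g s a t e → edge-from (edges g (to s) a (to t) (edge-to e))
      }

    ftG : FreeTransitive actG
    ftG s t with ftH (to s) (to t)
    ... | g , moves , unique = g , trans (cong from moves) (from-to t) ,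
      λ moves' → unique (trans (sym (to-from _)) (cong to moves'))

module CayleyProperties {A : Set} (D : CayleyData A) where
  open CayleyData D
  open Group (asGroup 𝔾) using (_∙_; _//_; assoc; identityˡ; identityʳ) renaming (ε to e)
  open GroupProperties (asGroup 𝔾) using (∙-cancelˡ; //-rightDividesˡ; x≈z//y)

  cayley-deterministic : Deterministic cayley
  cayley-deterministic g a s t (k , lk , s≡) (k' , lk' , t≡) =
    trans s≡ (trans (cong (g ∙_) (label-inj k k' (trans lk (sym lk')))) (sym t≡))

  -- Two edges g → t have generators g⁻¹ t, hence equal labels.
  cayley-simple : Simple cayley
  cayley-simple g t a b (k , lk , t≡) (k' , lk' , t≡') =
    trans (sym lk) (trans (label-wd k k' (∙-cancelˡ g _ _ (trans (sym t≡) t≡'))) lk')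

  word-path : ∀ g ks → Star (Step cayley) g (g ∙ prod ks)
  word-path g [] = subst (Star (Step cayley) g) (sym (identityʳ g)) ε
  word-path g (k ∷ ks) = (label k , k , refl , refl) ◅
    subst (Star (Step cayley) (g ∙ ι k)) (assoc g (ι k) (prod ks)) (word-path (g ∙ ι k) ks)

  cayley-rooted : Generating → Rooted cayley
  cayley-rooted gen = e , λ g →
    let (ks , g≡) = gen g in
    subst (Star (Step cayley) e) (trans (identityˡ (prod ks)) (sym g≡)) (word-path e ks)

  left-multiplication : Action 𝔾 cayley
  left-multiplication = record
    { _•_      = _∙_
    ; identity = identityˡ
    ; compat   = assoc
    ; edges    = λ g s a t (k , lk , t≡) →
        k , lk , trans (cong (g ∙_) t≡) (sym (assoc g s (ι k)))
    }

  left-multiplication-free-transitive : FreeTransitive left-multiplication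
  left-multiplication-free-transitive s t =
    t // s , //-rightDividesˡ s t , λ {g} gs≡t → sym (x≈z//y g s t gs≡t)

module _ {A : Set} {𝔾 : Grp} {G : Graph A} (act : Action 𝔾 G) where
  open Group (asGroup 𝔾) using (_⁻¹; inverseˡ; inverseʳ)
  open Action act

  •-inverseˡ : ∀ g v → (g ⁻¹) • (g • v) ≡ v
  •-inverseˡ g v = trans (sym (compat _ _ _)) (trans (cong (_• v) (inverseˡ g)) (identity v))

  •-inverseʳ : ∀ g v → g • ((g ⁻¹) • v) ≡ v
  •-inverseʳ g v = trans (sym (compat _ _ _)) (trans (cong (_• v) (inverseʳ g)) (identity v))

  -- An edge between translates is already an edge: translate back by g⁻¹.
  edge-untranslate : ∀ g {s a t} → E G (g • s) a (g • t) → E G s a t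
  edge-untranslate g {s} {a} {t} e =
    subst₂ (λ u w → E G u a w) (•-inverseˡ g s) (•-inverseˡ g t) (edges (g ⁻¹) _ a _ e)

module FromAction {A : Set} (G : Graph A) (det : Deterministic G) (rt : Rooted G)
                  (simp : Simple G) (𝔾 : Grp) (act : Action 𝔾 G) (ft : FreeTransitive act) where
  open Group (asGroup 𝔾) using (Carrier; _∙_; _⁻¹; assoc; identityˡ; identityʳ) renaming (ε to e)
  open Action act

  root : V G
  root = proj₁ rt

  coord : V G → Carrier
  coord v = proj₁ (ft root v)

  coord-spec : ∀ v → coord v • root ≡ v
  coord-spec v = proj₁ (proj₂ (ft root v))

  coord-unique : ∀ {g v} → g • root ≡ v → coord v ≡ g
  coord-unique {v = v} = proj₂ (proj₂ (ft root v))

  coord-injective : ∀ {s t} → coord s ≡ coord t → s ≡ t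
  coord-injective {s} {t} p =
    trans (sym (coord-spec s)) (trans (cong (_• root) p) (coord-spec t))

  coord-• : ∀ g v → (g ∙ coord v) • root ≡ g • v
  coord-• g v = trans (compat _ _ _) (cong (g •_) (coord-spec v))

  edge-at-root : ∀ {s a t} → E G s a t → E G root a ((coord s ⁻¹) • t)
  edge-at-root {s} {a} {t} st = edge-untranslate act (coord s)
    (subst₂ (λ u w → E G u a w) (sym (coord-spec s)) (sym (•-inverseʳ act (coord s) t)) st)

  -- The generators: coordinates of the out-neighbours of the root.
  OutEdge : Set
  OutEdge = Σ A λ a → Σ (V G) λ t → E G root a t

  some-out-edge : OutEdge
  some-out-edge =
    let (s , a , t , st) = nonempty G in a , (coord s ⁻¹) • t , edge-at-root st

  cayleyData : CayleyData A
  cayleyData = record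
    { 𝔾 = 𝔾 ; K = OutEdge ; ι = λ (_ , t , _) → coord t ; k₀ = some-out-edge ; label = proj₁
    ; label-wd  = λ (a , t , r→t) (a' , t' , r→t') c≡ →
        simp root t a a' r→t (subst (E G root a') (sym (coord-injective c≡)) r→t')
    ; label-inj = λ (a , t , r→t) (a' , t' , r→t') a≡ →
        cong coord (det root a t t' r→t (subst (λ b → E G root b t') (sym a≡) r→t'))
    }
  open CayleyData cayleyData using (prod; cayley; Generating)

  edge-to-cayley : ∀ {s a t} → E G s a t → E cayley (coord s) a (coord t)
  edge-to-cayley {s} {a} {t} st = (a , _ , edge-at-root st) , refl ,
    coord-unique (trans (coord-• (coord s) _) (•-inverseʳ act (coord s) t))

  edge-from-cayley : ∀ {s a t} → E cayley (coord s) a (coord t) → E G s a t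
  edge-from-cayley {s} {a} {t} ((a' , t' , r→t') , a≡ , t≡) =
    subst₂ (λ u w → E G u a w) (coord-spec s) translate-t'
      (edges (coord s) root a t' (subst (λ b → E G root b t') a≡ r→t'))
    where
    translate-t' : coord s • t' ≡ t
    translate-t' = trans (sym (coord-• (coord s) t')) (trans (cong (_• root) (sym t≡)) (coord-spec t))

  coord-iso : G ≅ cayley
  coord-iso = coord , (coord-injective , λ g → g • root , λ z≡ → coord-unique (sym z≡)) ,
    λ s a t → mk⇔ edge-to-cayley edge-from-cayley

  path-word : ∀ {u v} → Star (Step G) u v → ∃[ ks ] coord v ≡ coord u ∙ prod ks
  path-word {u} ε = [] , sym (identityʳ (coord u))
  path-word {u} ((a , uw) ◅ path) with edge-to-cayley uw | path-word path
  ... | k , _ , w≡ | ks , v≡ =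
    k ∷ ks , trans v≡ (trans (cong (_∙ prod ks) w≡) (assoc _ _ _))

  -- Every g is the word read along a path from the root to g • root.
  generating : Generating
  generating g with path-word (proj₂ rt (g • root))
  ... | ks , c≡ = ks , (begin
    g                        ≡⟨ coord-unique refl ⟨
    coord (g • root)         ≡⟨ c≡ ⟩
    coord root ∙ prod ks     ≡⟨ cong (_∙ prod ks) (coord-unique (identity root)) ⟩
    e ∙ prod ks              ≡⟨ identityˡ (prod ks) ⟩
    prod ks                  ∎)
    where open ≡-Reasoning

proposition3p2 : {A : Set} (G : Graph A) →
    IsCayley G ⇔ (Deterministic G × Rooted G × Simple G × HasFreeTransitiveAction G)
proposition3p2 G = mk⇔ cayley⇒properties properties⇒cayley
  where
  cayley⇒properties : IsCayley G →
    Deterministic G × Rooted G × Simple G × HasFreeTransitiveAction G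
  cayley⇒properties (D , gen , iso) =
    deterministic-≅ cayley-deterministic ,
    rooted-≅ (cayley-rooted gen) ,
    simple-≅ cayley-simple ,
    freeTransitive-≅ (CayleyData.𝔾 D , left-multiplication , left-multiplication-free-transitive)
    where
    open CayleyProperties D
    open Transport {G = G} {H = CayleyData.cayley D} iso

  properties⇒cayley : Deterministic G × Rooted G × Simple G × HasFreeTransitiveAction G →
    IsCayley G
  properties⇒cayley (det , rt , simp , 𝔾 , act , ft) = cayleyData , generating , coord-iso
    where open FromAction G det rt simp 𝔾 act ft
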